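{- For every even integer $n\ge 8$ there exist a threshold network $\mathcal{T}$ on a signed graph $C_n$ whose loopless part is a cycle on $n$ vertices and which has a negative self-loop at every vertex, with some threshold vector $b\in\mathbb{Z}^n$, and a periodic update mode $\mu$, such that the dynamics $x\mapsto F_\mu(x)$ of $\mathcal{T}$ has an attractor of period $n-3$.
   Context: A signed graph has vertex set $V$, undirected edges between distinct vertices, self-loops, and a sign in $\{ -1,+1\}$ on every edge and loop. Its interaction matrix $W=(w_{ij})$ is symmetric with $w_{ij}$ the sign of edge $\{i,j\}$ (or of the loop at $i$ when $i=j$) and $0$ if absent. A threshold network with thresholds $b$ has local functions $f_i(x)=1$ if $\sum_{j}w_{ij}x_j-b_i>0$, $f_i(x)=x_i$ if it is $0$, $f_i(x)=-1$ otherwise, for $x\in\{ -1,1\}^V$. For $I\subseteq V$, $f_I(x)_i=f_i(x)$ if $i\in I$, else $x_i$. A periodic update mode is a finite sequence $\mu=(I_1,\ldots,I_\ell)$ of subsets of $V$ (a vertex may appear in several of them), with global map $F_\mu=f_{I_\ell}\circ\cdots\circ f_{I_1}$. An attractor of period $p$ is a configuration $x$ with $F_\mu^p(x)=x$ and $p\ge1$ minimal. -}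

module Defs where

open import Data.Nat as ℕ using (ℕ; zero; suc)
open import Data.Integer as ℤ using (ℤ; +_; -[1+_]; _+_; _-_; _*_; _<_; 0ℤ)
open import Data.Fin using (Fin; toℕ)
open import Data.Fin.Subset using (Subset; _∈_)
open import Data.Fin.Subset.Properties using (_∈?_)
open import Data.Bool using (Bool; true; false)
open import Data.List using (List; []; _∷_)
open import Data.Product using (_×_)
open import Data.Sum using (_⊎_)
open import Relation.Nullary using (¬_; yes; no)
open import Relation.Binary.PropositionalEquality using (_≡_; _≢_)

-- Signs / spins: a configuration value in {-1,+1} is encoded as a Bool,
-- true ↦ +1, false ↦ -1.
⟦_⟧ : Bool → ℤ
⟦ true ⟧  = + 1
⟦ false ⟧ = -[1+ 0 ]

Config : ℕ → Set
Config n = Fin n → Bool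

Matrix : ℕ → Set
Matrix n = Fin n → Fin n → ℤ

∑ : (n : ℕ) → (Fin n → ℤ) → ℤ
∑ zero    f = 0ℤ
∑ (suc n) f = f Fin.zero + ∑ n (λ i → f (Fin.suc i))
  where import Data.Fin as Fin

CycSucc : (n : ℕ) → Fin n → Fin n → Set
CycSucc n i j = (toℕ j ≡ suc (toℕ i)) ⊎ (suc (toℕ i) ≡ n × toℕ j ≡ 0)

CycAdj : (n : ℕ) → Fin n → Fin n → Set
CycAdj n i j = CycSucc n i j ⊎ CycSucc n j i

IsSign : ℤ → Set
IsSign w = (w ≡ + 1) ⊎ (w ≡ -[1+ 0 ])

IsSignedCycleNegLoops : (n : ℕ) → Matrix n → Set
IsSignedCycleNegLoops n W =
    (∀ i j → W i j ≡ W j i)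
  × (∀ i → W i i ≡ -[1+ 0 ])
  × (∀ i j → i ≢ j → CycAdj n i j → IsSign (W i j))
  × (∀ i j → i ≢ j → ¬ CycAdj n i j → W i j ≡ 0ℤ)

localF : (n : ℕ) → Matrix n → (Fin n → ℤ) → Config n → Fin n → Bool
localF n W b x i with ∑ n (λ j → W i j * ⟦ x j ⟧) - b i
... | s with 0ℤ ℤ.<? s
...   | yes _ = true
...   | no _ with s ℤ.≟ 0ℤ
...     | yes _ = x i
...     | no _  = false

blockF : (n : ℕ) → Matrix n → (Fin n → ℤ) → Subset n → Config n → Config n
blockF n W b I x i with i ∈? I
... | yes _ = localF n W b x i
... | no _  = x i

globalF : (n : ℕ) → Matrix n → (Fin n → ℤ) → List (Subset n) → Config n → Config n
globalF n W b []       x = x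
globalF n W b (I ∷ μ) x = globalF n W b μ (blockF n W b I x)

iter : {A : Set} → (A → A) → ℕ → A → A
iter F zero    x = x
iter F (suc k) x = F (iter F k x)

_≈_ : {n : ℕ} → Config n → Config n → Set
x ≈ y = ∀ i → x i ≡ y i

IsAttractorOfPeriod : {n : ℕ} → (Config n → Config n) → Config n → ℕ → Set
IsAttractorOfPeriod F x p =
    1 ℕ.≤ p
  × iter F p x ≈ x
  × (∀ q → 1 ℕ.≤ q → q ℕ.< p → ¬ (iter F q x ≈ x))

-- All cycle edges are positive, every loop is negative and every threshold is 0, so the local
-- field at i is x(i+1) + x(i-1) - x(i): whenever x(i+1) = x(i) it equals x(i-1) ≠ 0, and
-- updating i copies its predecessor. Updating n-1, n-2, ..., 3 one at a time and then 0, 1, 2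
-- therefore shifts any configuration that is constant on {n-1, 0, 1, 2} one step along the
-- cycle, these four vertices acting as a single cell. A lone +1 token on the resulting ring of
-- n - 3 cells comes back after exactly n - 3 steps.
module Submission where

open import Defs
open import Data.Bool using (Bool; true; false; if_then_else_)
open import Data.Fin as F using (Fin; toℕ)
open import Data.Fin.Properties using (toℕ-injective; toℕ-fromℕ<; toℕ<n; 0≢1+n; suc-injective)
open import Data.Fin.Subset using (Subset; ⁅_⁆)
open import Data.Fin.Subset.Properties using (_∈?_; x∈⁅x⁆; x∈⁅y⁆⇒x≡y)
open import Data.Integer as ℤ using (ℤ; +_; -[1+_]; _+_; _-_; _*_; -_; 0ℤ)
import Data.Integer.Properties as ℤP
open import Data.List using (List; []; _∷_; _++_)
open import Data.Nat as ℕ using (ℕ; zero; suc; pred; _≤_; _<_; _∸_; z≤n; s≤s; _%_)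
import Data.Nat.Properties as ℕP
open import Data.Nat.DivMod using (_mod_; n%n≡0; m<n⇒m%n≡m)
open import Data.Nat.Divisibility using (_∣_)
open import Data.Product using (Σ; _×_; _,_)
open import Data.Sum using (inj₁; inj₂; [_,_]′)
open import Function using (_∘_)
open import Relation.Nullary using (¬_; Dec; yes; no; does; contradiction)
open import Relation.Nullary.Decidable using (_×-dec_; _⊎-dec_; dec-true; dec-false)
open import Relation.Binary.PropositionalEquality
open import Algebra.Properties.CommutativeSemigroup ℤP.+-commutativeSemigroup
  using (interchange)

𝟙 : ∀ {a} {A : Set a} → Dec A → ℤ
𝟙 (yes _) = + 1
𝟙 (no _)  = 0ℤ

𝟙-yes : ∀ {a} {A : Set a} (a? : Dec A) → A → 𝟙 a? ≡ + 1
𝟙-yes (yes _) _ = refl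
𝟙-yes (no ¬a) a = contradiction a ¬a

𝟙-no : ∀ {a} {A : Set a} (a? : Dec A) → ¬ A → 𝟙 a? ≡ 0ℤ
𝟙-no (yes a) ¬a = contradiction a ¬a
𝟙-no (no _)  _  = refl

𝟙-cong : ∀ {a b} {A : Set a} {B : Set b} (a? : Dec A) (b? : Dec B) →
         (A → B) → (B → A) → 𝟙 a? ≡ 𝟙 b?
𝟙-cong (yes _) (yes _) _   _   = refl
𝟙-cong (no _)  (no _)  _   _   = refl
𝟙-cong (yes a) (no ¬b) a→b _   = contradiction (a→b a) ¬b
𝟙-cong (no ¬a) (yes b) _   b→a = contradiction (b→a b) ¬a

∑-cong : ∀ n {f g : Fin n → ℤ} → (∀ j → f j ≡ g j) → ∑ n f ≡ ∑ n g
∑-cong zero    f≗g = refl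
∑-cong (suc n) f≗g = cong₂ _+_ (f≗g F.zero) (∑-cong n (f≗g ∘ F.suc))

∑-distrib-+ : ∀ n (f g : Fin n → ℤ) → ∑ n (λ j → f j + g j) ≡ ∑ n f + ∑ n g
∑-distrib-+ zero    f g = refl
∑-distrib-+ (suc n) f g =
  trans (cong (λ t → f F.zero + g F.zero + t) (∑-distrib-+ n (f ∘ F.suc) (g ∘ F.suc)))
        (interchange (f F.zero) (g F.zero) (∑ n (f ∘ F.suc)) (∑ n (g ∘ F.suc)))

∑-𝟙*-none : ∀ n {P : Fin n → Set} (P? : ∀ j → Dec (P j)) (f : Fin n → ℤ) →
            (∀ j → ¬ P j) → ∑ n (λ j → 𝟙 (P? j) * f j) ≡ 0ℤ
∑-𝟙*-none zero    P? f ¬P = refl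
∑-𝟙*-none (suc n) P? f ¬P = cong₂ _+_
  (cong (_* f F.zero) (𝟙-no (P? F.zero) (¬P F.zero)))
  (∑-𝟙*-none n (P? ∘ F.suc) (f ∘ F.suc) (¬P ∘ F.suc))

∑-𝟙*-unique : ∀ n {P : Fin n → Set} (P? : ∀ j → Dec (P j)) (f : Fin n → ℤ) {b} →
              P b → (∀ {j} → P j → j ≡ b) → ∑ n (λ j → 𝟙 (P? j) * f j) ≡ f b
∑-𝟙*-unique (suc n) P? f {F.zero} Pb unique = begin
  𝟙 (P? F.zero) * f F.zero + ∑ n (λ j → 𝟙 (P? (F.suc j)) * f (F.suc j))
    ≡⟨ cong₂ (λ u v → u * f F.zero + v) (𝟙-yes (P? F.zero) Pb)
             (∑-𝟙*-none n (P? ∘ F.suc) (f ∘ F.suc) (λ j → 0≢1+n ∘ sym ∘ unique)) ⟩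
  + 1 * f F.zero + 0ℤ
    ≡⟨ trans (ℤP.+-identityʳ _) (ℤP.*-identityˡ _) ⟩
  f F.zero ∎
  where open ≡-Reasoning
∑-𝟙*-unique (suc n) P? f {F.suc b} Pb unique = begin
  𝟙 (P? F.zero) * f F.zero + ∑ n (λ j → 𝟙 (P? (F.suc j)) * f (F.suc j))
    ≡⟨ cong (λ u → u * f F.zero + ∑ n (λ j → 𝟙 (P? (F.suc j)) * f (F.suc j)))
            (𝟙-no (P? F.zero) (0≢1+n ∘ unique)) ⟩
  0ℤ + ∑ n (λ j → 𝟙 (P? (F.suc j)) * f (F.suc j))
    ≡⟨ ℤP.+-identityˡ _ ⟩
  ∑ n (λ j → 𝟙 (P? (F.suc j)) * f (F.suc j))
    ≡⟨ ∑-𝟙*-unique n (P? ∘ F.suc) (f ∘ F.suc) Pb (suc-injective ∘ unique) ⟩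
  f (F.suc b) ∎
  where open ≡-Reasoning

cycSucc? : ∀ n (i j : Fin n) → Dec (CycSucc n i j)
cycSucc? n i j = (toℕ j ℕ.≟ suc (toℕ i)) ⊎-dec ((suc (toℕ i) ℕ.≟ n) ×-dec (toℕ j ℕ.≟ 0))

cycSucc-functional : ∀ {n} {i j k : Fin n} → CycSucc n i j → CycSucc n i k → j ≡ k
cycSucc-functional (inj₁ j≡1+i) (inj₁ k≡1+i) = toℕ-injective (trans j≡1+i (sym k≡1+i))
cycSucc-functional (inj₂ (_ , j≡0)) (inj₂ (_ , k≡0)) = toℕ-injective (trans j≡0 (sym k≡0))
cycSucc-functional {j = j} (inj₁ j≡1+i) (inj₂ (1+i≡n , _)) =
  contradiction (trans j≡1+i 1+i≡n) (ℕP.<⇒≢ (toℕ<n j))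
cycSucc-functional {k = k} (inj₂ (1+i≡n , _)) (inj₁ k≡1+i) =
  contradiction (trans k≡1+i 1+i≡n) (ℕP.<⇒≢ (toℕ<n k))

cycSucc-injective : ∀ {n} {i j k : Fin n} → CycSucc n i k → CycSucc n j k → i ≡ j
cycSucc-injective (inj₁ k≡1+i) (inj₁ k≡1+j) =
  toℕ-injective (ℕP.suc-injective (trans (sym k≡1+i) k≡1+j))
cycSucc-injective (inj₂ (1+i≡n , _)) (inj₂ (1+j≡n , _)) =
  toℕ-injective (ℕP.suc-injective (trans 1+i≡n (sym 1+j≡n)))
cycSucc-injective (inj₁ k≡1+i) (inj₂ (_ , k≡0)) = contradiction (trans (sym k≡1+i) k≡0) λ ()
cycSucc-injective (inj₂ (_ , k≡0)) (inj₁ k≡1+j) = contradiction (trans (sym k≡1+j) k≡0) λ ()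

cycSucc-irrefl : ∀ {n} → 2 ≤ n → {i : Fin n} → ¬ CycSucc n i i
cycSucc-irrefl _ (inj₁ i≡1+i) = ℕP.1+n≢n (sym i≡1+i)
cycSucc-irrefl 2≤n (inj₂ (1+i≡n , i≡0)) =
  ℕP.<⇒≱ (s≤s (s≤s z≤n)) (subst (2 ≤_) (trans (sym 1+i≡n) (cong suc i≡0)) 2≤n)

cycSucc-asym : ∀ {n} → 3 ≤ n → {i j : Fin n} → CycSucc n i j → ¬ CycSucc n j i
cycSucc-asym _ (inj₁ j≡1+i) (inj₁ i≡1+j) =
  ℕP.<⇒≢ (ℕP.<-trans (ℕP.n<1+n _) (ℕP.n<1+n _)) (trans j≡1+i (cong suc i≡1+j))
cycSucc-asym 3≤n (inj₁ j≡1+i) (inj₂ (1+j≡n , i≡0)) =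
  ℕP.<⇒≱ (s≤s (s≤s (s≤s z≤n)))
    (subst (3 ≤_) (trans (sym 1+j≡n) (cong suc (trans j≡1+i (cong suc i≡0)))) 3≤n)
cycSucc-asym 3≤n (inj₂ (1+i≡n , j≡0)) (inj₁ i≡1+j) =
  ℕP.<⇒≱ (s≤s (s≤s (s≤s z≤n)))
    (subst (3 ≤_) (trans (sym 1+i≡n) (cong suc (trans i≡1+j (cong suc j≡0)))) 3≤n)
cycSucc-asym 3≤n (inj₂ (1+i≡n , _)) (inj₂ (_ , i≡0)) =
  ℕP.<⇒≱ (s≤s (s≤s z≤n)) (subst (3 ≤_) (trans (sym 1+i≡n) (cong suc i≡0)) 3≤n)

-- A sum of indicators rather than a case split, so that the local field splits by linearity.
cycleW : (n : ℕ) → Matrix n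
cycleW n i j = 𝟙 (cycSucc? n i j) + 𝟙 (cycSucc? n j i) - 𝟙 (i F.≟ j)

cycleW-isSignedCycleNegLoops : ∀ n → 3 ≤ n → IsSignedCycleNegLoops n (cycleW n)
cycleW-isSignedCycleNegLoops n 3≤n = symmetric , negativeLoop , signedEdge , noEdge
  where
  symmetric : ∀ i j → cycleW n i j ≡ cycleW n j i
  symmetric i j = cong₂ _-_ (ℤP.+-comm (𝟙 (cycSucc? n i j)) (𝟙 (cycSucc? n j i)))
                            (𝟙-cong (i F.≟ j) (j F.≟ i) sym sym)

  negativeLoop : ∀ i → cycleW n i i ≡ -[1+ 0 ]
  negativeLoop i
    rewrite 𝟙-no (cycSucc? n i i) (cycSucc-irrefl (ℕP.≤-trans (ℕP.n≤1+n 2) 3≤n))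
          | 𝟙-yes (i F.≟ i) refl = refl

  signedEdge : ∀ i j → i ≢ j → CycAdj n i j → IsSign (cycleW n i j)
  signedEdge i j i≢j (inj₁ ij)
    rewrite 𝟙-yes (cycSucc? n i j) ij | 𝟙-no (cycSucc? n j i) (cycSucc-asym 3≤n ij)
          | 𝟙-no (i F.≟ j) i≢j = inj₁ refl
  signedEdge i j i≢j (inj₂ ji)
    rewrite 𝟙-no (cycSucc? n i j) (cycSucc-asym 3≤n ji) | 𝟙-yes (cycSucc? n j i) ji
          | 𝟙-no (i F.≟ j) i≢j = inj₁ refl

  noEdge : ∀ i j → i ≢ j → ¬ CycAdj n i j → cycleW n i j ≡ 0ℤ
  noEdge i j i≢j ¬adj
    rewrite 𝟙-no (cycSucc? n i j) (¬adj ∘ inj₁) | 𝟙-no (cycSucc? n j i) (¬adj ∘ inj₂)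
          | 𝟙-no (i F.≟ j) i≢j = refl

cycleW-field : ∀ n (v : Fin n → ℤ) {a s p : Fin n} → CycSucc n a s → CycSucc n p a →
               ∑ n (λ j → cycleW n a j * v j) ≡ v s + v p - v a
cycleW-field n v {a} {s} {p} as pa = begin
  ∑ n (λ j → (σ j + π j - δ j) * v j)         ≡⟨ ∑-cong n distribute ⟩
  ∑ n (λ j → σ j * v j + π j * v j + δ j * - v j)
    ≡⟨ trans (∑-distrib-+ n _ _) (cong (_+ ∑ n (λ j → δ j * - v j)) (∑-distrib-+ n _ _)) ⟩
  ∑ n (λ j → σ j * v j) + ∑ n (λ j → π j * v j) + ∑ n (λ j → δ j * - v j)
    ≡⟨ cong₂ _+_ (cong₂ _+_
         (∑-𝟙*-unique n (cycSucc? n a) v as (λ aj → cycSucc-functional aj as))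
         (∑-𝟙*-unique n (λ j → cycSucc? n j a) v pa (λ ja → cycSucc-injective ja pa)))
         (∑-𝟙*-unique n (a F.≟_) (-_ ∘ v) refl sym) ⟩
  v s + v p - v a ∎
  where
  open ≡-Reasoning
  σ π δ : Fin n → ℤ
  σ j = 𝟙 (cycSucc? n a j)
  π j = 𝟙 (cycSucc? n j a)
  δ j = 𝟙 (a F.≟ j)
  distribute : ∀ j → (σ j + π j - δ j) * v j ≡ σ j * v j + π j * v j + δ j * - v j
  distribute j = begin
    (σ j + π j - δ j) * v j              ≡⟨ ℤP.*-distribʳ-+ (v j) (σ j + π j) (- δ j) ⟩
    (σ j + π j) * v j + - δ j * v j      ≡⟨ cong₂ _+_ (ℤP.*-distribʳ-+ (v j) (σ j) (π j))
                                                     (trans (sym (ℤP.neg-distribˡ-* (δ j) (v j)))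
                                                            (ℤP.neg-distribʳ-* (δ j) (v j))) ⟩
    σ j * v j + π j * v j + δ j * - v j ∎

threshold : ℤ → Bool → Bool
threshold s xᵢ with 0ℤ ℤ.<? s
... | yes _ = true
... | no _ with s ℤ.≟ 0ℤ
...   | yes _ = xᵢ
...   | no _  = false

localF-threshold : ∀ n W b (x : Config n) i →
                   localF n W b x i ≡ threshold (∑ n (λ j → W i j * ⟦ x j ⟧) - b i) (x i)
localF-threshold n W b x i with ∑ n (λ j → W i j * ⟦ x j ⟧) - b i
... | s with 0ℤ ℤ.<? s
...   | yes _ = refl
...   | no _ with s ℤ.≟ 0ℤ
...     | yes _ = refl
...     | no _  = refl

threshold-copy : ∀ u v → threshold (⟦ u ⟧ + ⟦ v ⟧ - ⟦ u ⟧ - 0ℤ) u ≡ v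
threshold-copy true  true  = refl
threshold-copy true  false = refl
threshold-copy false true  = refl
threshold-copy false false = refl

localF-cycleW-copy : ∀ n (x : Config n) {a s p : Fin n} → CycSucc n a s → CycSucc n p a →
                     x s ≡ x a → localF n (cycleW n) (λ _ → 0ℤ) x a ≡ x p
localF-cycleW-copy n x {a} {s} {p} as pa xs≡xa = begin
  localF n (cycleW n) (λ _ → 0ℤ) x a
    ≡⟨ localF-threshold n (cycleW n) (λ _ → 0ℤ) x a ⟩
  threshold (∑ n (λ j → cycleW n a j * ⟦ x j ⟧) - 0ℤ) (x a)
    ≡⟨ cong (λ t → threshold (t - 0ℤ) (x a)) (cycleW-field n (⟦_⟧ ∘ x) as pa) ⟩
  threshold (⟦ x s ⟧ + ⟦ x p ⟧ - ⟦ x a ⟧ - 0ℤ) (x a)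
    ≡⟨ cong (λ u → threshold (⟦ u ⟧ + ⟦ x p ⟧ - ⟦ x a ⟧ - 0ℤ) (x a)) xs≡xa ⟩
  threshold (⟦ x a ⟧ + ⟦ x p ⟧ - ⟦ x a ⟧ - 0ℤ) (x a)
    ≡⟨ threshold-copy (x a) (x p) ⟩
  x p ∎
  where open ≡-Reasoning

blockF-⁅⁆-self : ∀ n W b c (x : Config n) → blockF n W b ⁅ c ⁆ x c ≡ localF n W b x c
blockF-⁅⁆-self n W b c x with c ∈? ⁅ c ⁆
... | yes _   = refl
... | no c∉c = contradiction (x∈⁅x⁆ c) c∉c

blockF-⁅⁆-other : ∀ n W b c (x : Config n) i → i ≢ c → blockF n W b ⁅ c ⁆ x i ≡ x i
blockF-⁅⁆-other n W b c x i i≢c with i ∈? ⁅ c ⁆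
... | yes i∈c = contradiction (x∈⁅y⁆⇒x≡y c i∈c) i≢c
... | no _    = refl

globalF-++ : ∀ n W b μ ν (x : Config n) →
             globalF n W b (μ ++ ν) x ≡ globalF n W b ν (globalF n W b μ x)
globalF-++ n W b []      ν x = refl
globalF-++ n W b (I ∷ μ) ν x = globalF-++ n W b μ ν (blockF n W b I x)

≈-trans : ∀ {n} {x y z : Config n} → x ≈ y → y ≈ z → x ≈ z
≈-trans x≈y y≈z i = trans (x≈y i) (y≈z i)

module CycleShift (k : ℕ) where

  n : ℕ
  n = 5 ℕ.+ k

  W : Matrix n
  W = cycleW n

  b : Fin n → ℤ
  b _ = 0ℤ

  ⌜_⌝ : (ℕ → Bool) → Config n
  ⌜ g ⌝ i = g (toℕ i)

  _[_≔_] : (ℕ → Bool) → ℕ → Bool → ℕ → Bool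
  (g [ c ≔ v ]) m = if does (m ℕ.≟ c) then v else g m

  ≔-same : ∀ g c v → (g [ c ≔ v ]) c ≡ v
  ≔-same g c v rewrite dec-true (c ℕ.≟ c) refl = refl

  ≔-other : ∀ g {c m} v → m ≢ c → (g [ c ≔ v ]) m ≡ g m
  ≔-other g {c} {m} v m≢c rewrite dec-false (m ℕ.≟ c) m≢c = refl

  prev : ℕ → ℕ
  prev zero    = 4 ℕ.+ k
  prev (suc c) = c

  prev-< : ∀ {c} → c < n → prev c < n
  prev-< {zero}  _   = ℕP.n<1+n _
  prev-< {suc c} c<n = ℕP.<-trans (ℕP.n<1+n c) c<n

  toℕ-mod : ∀ {c} → c < n → toℕ (c mod n) ≡ c
  toℕ-mod c<n = trans (toℕ-fromℕ< _) (m<n⇒m%n≡m c<n)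

  cycSucc-mod-suc : ∀ {c} → c < n → CycSucc n (c mod n) (suc c mod n)
  cycSucc-mod-suc {c} c<n with ℕP.m≤n⇒m<n∨m≡n c<n
  ... | inj₁ 1+c<n = inj₁ (trans (toℕ-mod 1+c<n) (cong suc (sym (toℕ-mod c<n))))
  ... | inj₂ 1+c≡n = inj₂ (trans (cong suc (toℕ-mod c<n)) 1+c≡n
                          , trans (toℕ-fromℕ< _) (trans (cong (λ m → m % n) 1+c≡n) (n%n≡0 n)))

  cycSucc-mod-prev : ∀ {c} → c < n → CycSucc n (prev c mod n) (c mod n)
  cycSucc-mod-prev {zero}  c<n = inj₂ (cong suc (toℕ-mod (prev-< c<n)) , toℕ-mod c<n)
  cycSucc-mod-prev {suc c} c<n = inj₁ (trans (toℕ-mod c<n) (cong suc (sym (toℕ-mod (prev-< c<n)))))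

  update-step : ∀ {x : Config n} {g} c → c < n → x ≈ ⌜ g ⌝ → g (suc c % n) ≡ g c →
                blockF n W b ⁅ c mod n ⁆ x ≈ ⌜ g [ c ≔ g (prev c) ] ⌝
  update-step {x} {g} c c<n x≈g gₛ≡gc i with toℕ i ℕ.≟ c
  ... | yes refl = begin
    blockF n W b ⁅ c mod n ⁆ x i
      ≡⟨ cong (blockF n W b ⁅ c mod n ⁆ x) i≡c ⟩
    blockF n W b ⁅ c mod n ⁆ x (c mod n)
      ≡⟨ blockF-⁅⁆-self n W b (c mod n) x ⟩
    localF n W b x (c mod n)
      ≡⟨ localF-cycleW-copy n x (cycSucc-mod-suc c<n) (cycSucc-mod-prev c<n) xₛ≡xc ⟩
    x (prev c mod n)
      ≡⟨ trans (x≈g _) (cong g (toℕ-mod (prev-< c<n))) ⟩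
    g (prev c)
      ≡⟨ ≔-same g c (g (prev c)) ⟨
    (g [ c ≔ g (prev c) ]) c ∎
    where
    open ≡-Reasoning
    i≡c : i ≡ c mod n
    i≡c = toℕ-injective (sym (toℕ-mod c<n))
    xₛ≡xc : x (suc c mod n) ≡ x (c mod n)
    xₛ≡xc = begin
      x (suc c mod n) ≡⟨ trans (x≈g _) (cong g (toℕ-fromℕ< _)) ⟩
      g (suc c % n)   ≡⟨ gₛ≡gc ⟩
      g c             ≡⟨ trans (x≈g _) (cong g (toℕ-mod c<n)) ⟨
      x (c mod n)     ∎
  ... | no i≢c = begin
    blockF n W b ⁅ c mod n ⁆ x i   ≡⟨ blockF-⁅⁆-other n W b (c mod n) x i i≢c′ ⟩
    x i                            ≡⟨ x≈g i ⟩
    g (toℕ i)                      ≡⟨ ≔-other g (g (prev c)) i≢c ⟨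
    (g [ c ≔ g (prev c) ]) (toℕ i) ∎
    where
    open ≡-Reasoning
    i≢c′ : i ≢ c mod n
    i≢c′ i≡c = i≢c (trans (cong toℕ i≡c) (toℕ-mod c<n))

  shiftedAbove : ℕ → (ℕ → Bool) → ℕ → Bool
  shiftedAbove c g m = if does (m ℕ.<? c) then g m else g (pred m)

  shiftedAbove-below : ∀ {c} g {m} → m < c → shiftedAbove c g m ≡ g m
  shiftedAbove-below {c} g {m} m<c rewrite dec-true (m ℕ.<? c) m<c = refl

  shiftedAbove-above : ∀ {c} g {m} → ¬ m < c → shiftedAbove c g m ≡ g (pred m)
  shiftedAbove-above {c} g {m} m≮c rewrite dec-false (m ℕ.<? c) m≮c = refl

  shiftedAbove-lower : ∀ c g m → let h = shiftedAbove (suc (suc c)) g in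
                       (h [ suc c ≔ h c ]) m ≡ shiftedAbove (suc c) g m
  shiftedAbove-lower c g m with m ℕ.≟ suc c
  ... | yes refl = trans (≔-same (shiftedAbove (suc (suc c)) g) (suc c) _)
                         (trans (shiftedAbove-below g (ℕP.<-trans (ℕP.n<1+n c) (ℕP.n<1+n (suc c))))
                                (sym (shiftedAbove-above g (ℕP.<-irrefl refl))))
  ... | no m≢1+c =
    trans (≔-other (shiftedAbove (suc (suc c)) g) _ m≢1+c) (same-side (m ℕ.<? suc c))
    where
    same-side : Dec (m < suc c) → shiftedAbove (suc (suc c)) g m ≡ shiftedAbove (suc c) g m
    same-side (yes m<1+c) =
      trans (shiftedAbove-below g (ℕP.m<n⇒m<1+n m<1+c)) (sym (shiftedAbove-below g m<1+c))
    same-side (no m≮1+c)  =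
      trans (shiftedAbove-above g m≮2+c) (sym (shiftedAbove-above g m≮1+c))
      where
      m≮2+c : ¬ m < suc (suc c)
      m≮2+c m<2+c = [ m≮1+c , m≢1+c ]′ (ℕP.m<1+n⇒m<n∨m≡n m<2+c)

  shiftedAbove-next : ∀ g → g 0 ≡ g (4 ℕ.+ k) → ∀ t → 4 ℕ.+ t ≤ n →
                      let h = shiftedAbove (4 ℕ.+ t) g in h ((4 ℕ.+ t) % n) ≡ h (3 ℕ.+ t)
  shiftedAbove-next g g₀≡gₗ t 4+t≤n with ℕP.m≤n⇒m<n∨m≡n 4+t≤n
  ... | inj₁ 4+t<n rewrite m<n⇒m%n≡m 4+t<n =
    trans (shiftedAbove-above g (ℕP.<-irrefl refl)) (sym (shiftedAbove-below g (ℕP.n<1+n _)))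
  ... | inj₂ 4+t≡n = begin
    h ((4 ℕ.+ t) % n) ≡⟨ cong h (trans (cong (λ m → m % n) 4+t≡n) (n%n≡0 n)) ⟩
    h 0               ≡⟨ shiftedAbove-below {4 ℕ.+ t} g (s≤s z≤n) ⟩
    g 0               ≡⟨ g₀≡gₗ ⟩
    g (4 ℕ.+ k)       ≡⟨ cong g (ℕP.suc-injective 4+t≡n) ⟨
    g (3 ℕ.+ t)       ≡⟨ shiftedAbove-below g (ℕP.n<1+n _) ⟨
    h (3 ℕ.+ t)       ∎
    where
    open ≡-Reasoning
    h = shiftedAbove (4 ℕ.+ t) g

  sweepDown : ℕ → List (Subset n)
  sweepDown zero    = []
  sweepDown (suc t) = ⁅ (3 ℕ.+ t) mod n ⁆ ∷ sweepDown t

  sweepDown-shifts : ∀ g → g 0 ≡ g (4 ℕ.+ k) → ∀ t → 3 ℕ.+ t ≤ n → ∀ {x} →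
                     x ≈ ⌜ shiftedAbove (3 ℕ.+ t) g ⌝ →
                     globalF n W b (sweepDown t) x ≈ ⌜ shiftedAbove 3 g ⌝
  sweepDown-shifts g g₀≡gₗ zero    _      x≈h = x≈h
  sweepDown-shifts g g₀≡gₗ (suc t) 4+t≤n x≈h =
    sweepDown-shifts g g₀≡gₗ t (ℕP.<⇒≤ 4+t≤n)
      (≈-trans (update-step {g = shiftedAbove (4 ℕ.+ t) g} (3 ℕ.+ t) 4+t≤n x≈h
                              (shiftedAbove-next g g₀≡gₗ t 4+t≤n))
               (shiftedAbove-lower (2 ℕ.+ t) g ∘ toℕ))

  μ : List (Subset n)
  μ = sweepDown (2 ℕ.+ k) ++ ⁅ 0 mod n ⁆ ∷ ⁅ 1 mod n ⁆ ∷ ⁅ 2 mod n ⁆ ∷ []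

  F : Config n → Config n
  F = globalF n W b μ

  rotate : (ℕ → Bool) → ℕ → Bool
  rotate g 0                    = g (3 ℕ.+ k)
  rotate g 1                    = g (3 ℕ.+ k)
  rotate g 2                    = g (3 ℕ.+ k)
  rotate g (suc (suc (suc m))) = g (2 ℕ.+ m)

  F-rotates : ∀ g → g 1 ≡ g 0 → g 2 ≡ g 1 → g 0 ≡ g (4 ℕ.+ k) →
              ∀ {x} → x ≈ ⌜ g ⌝ → F x ≈ ⌜ rotate g ⌝
  F-rotates g g₁≡g₀ g₂≡g₁ g₀≡gₗ {x} x≈g =
    ≈-trans (λ i → cong (λ y → y i) (globalF-++ n W b (sweepDown (2 ℕ.+ k)) _ x))
            (≈-trans (update-step {g = h₂} 2 (s≤s (s≤s (s≤s z≤n)))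
                       (update-step {g = h₁} 1 (s≤s (s≤s z≤n))
                         (update-step {g = h₀} 0 (s≤s z≤n) swept g₁≡g₀) g₂≡g₁) refl)
                     (h₃≡rotate ∘ toℕ))
    where
    h₀ h₁ h₂ : ℕ → Bool
    h₀ = shiftedAbove 3 g
    h₁ = h₀ [ 0 ≔ h₀ (prev 0) ]
    h₂ = h₁ [ 1 ≔ h₁ 0 ]

    swept : globalF n W b (sweepDown (2 ℕ.+ k)) x ≈ ⌜ h₀ ⌝
    swept = sweepDown-shifts g g₀≡gₗ (2 ℕ.+ k) ℕP.≤-refl
              (λ i → trans (x≈g i) (sym (shiftedAbove-below g (toℕ<n i))))

    h₃≡rotate : ∀ m → (h₂ [ 2 ≔ h₂ 1 ]) m ≡ rotate g m
    h₃≡rotate 0                    = refl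
    h₃≡rotate 1                    = refl
    h₃≡rotate 2                    = refl
    h₃≡rotate (suc (suc (suc m))) = refl

  -- Vertex 3 + j is cell j; vertices n-1, 0, 1, 2 together form cell 1 + k.
  cell : ℕ → ℕ
  cell 0                    = 1 ℕ.+ k
  cell 1                    = 1 ℕ.+ k
  cell 2                    = 1 ℕ.+ k
  cell (suc (suc (suc m))) = m

  token : ℕ → ℕ → Bool
  token p m = does (cell m ℕ.≟ p)

  rotate-token : ∀ {p} → p < 1 ℕ.+ k → ∀ m → rotate (token p) m ≡ token (suc p) m
  rotate-token _     0                          = refl
  rotate-token _     1                          = refl
  rotate-token _     2                          = refl
  rotate-token p<1+k 3                          = dec-false (1 ℕ.+ k ℕ.≟ _) (ℕP.<⇒≢ p<1+k ∘ sym)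
  rotate-token _     (suc (suc (suc (suc m)))) = refl

  rotate-token-last : ∀ m → m < n → rotate (token (1 ℕ.+ k)) m ≡ token 0 m
  rotate-token-last 0 _ = dec-false (k ℕ.≟ 1 ℕ.+ k) (ℕP.<⇒≢ (ℕP.n<1+n k))
  rotate-token-last 1 _ = dec-false (k ℕ.≟ 1 ℕ.+ k) (ℕP.<⇒≢ (ℕP.n<1+n k))
  rotate-token-last 2 _ = dec-false (k ℕ.≟ 1 ℕ.+ k) (ℕP.<⇒≢ (ℕP.n<1+n k))
  rotate-token-last 3 _ = dec-true (1 ℕ.+ k ℕ.≟ 1 ℕ.+ k) refl
  rotate-token-last (suc (suc (suc (suc m)))) (s≤s (s≤s (s≤s (s≤s m<1+k)))) =
    dec-false (m ℕ.≟ 1 ℕ.+ k) (ℕP.<⇒≢ m<1+k)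

  x₀ : Config n
  x₀ = ⌜ token 0 ⌝

  token-orbit : ∀ q → q ≤ 1 ℕ.+ k → iter F q x₀ ≈ ⌜ token q ⌝
  token-orbit zero    _      _ = refl
  token-orbit (suc q) q<1+k =
    ≈-trans (F-rotates (token q) refl refl refl (token-orbit q (ℕP.<⇒≤ q<1+k)))
            (rotate-token q<1+k ∘ toℕ)

  x₀-returns : iter F (2 ℕ.+ k) x₀ ≈ x₀
  x₀-returns =
    ≈-trans (F-rotates (token (1 ℕ.+ k)) refl refl refl (token-orbit (1 ℕ.+ k) ℕP.≤-refl))
            (λ i → rotate-token-last (toℕ i) (toℕ<n i))

  x₀-not-earlier : ∀ q → 1 ≤ q → q < 2 ℕ.+ k → ¬ iter F q x₀ ≈ x₀
  x₀-not-earlier (suc q) _ (s≤s q<1+k) returns =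
    contradiction (trans (sym (token-orbit (suc q) q<1+k vertex₃)) (returns vertex₃)) λ ()
    where
    vertex₃ : Fin n
    vertex₃ = F.suc (F.suc (F.suc F.zero))

  x₀-attractor : IsAttractorOfPeriod F x₀ (n ∸ 3)
  x₀-attractor = s≤s z≤n , x₀-returns , x₀-not-earlier

lemma3 : (n : ℕ) → 8 ≤ n → 2 ∣ n →
    Σ (Matrix n) λ W → IsSignedCycleNegLoops n W ×
    Σ (Fin n → ℤ) λ b → Σ (List (Subset n)) λ μ → Σ (Config n) λ x →
    IsAttractorOfPeriod (globalF n W b μ) x (n ∸ 3)
lemma3 (suc (suc (suc (suc (suc k))))) (s≤s (s≤s (s≤s (s≤s (s≤s _))))) _ =
  W , cycleW-isSignedCycleNegLoops n (s≤s (s≤s (s≤s z≤n))) , b , μ , x₀ , x₀-attractor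
  where open CycleShift k
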